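{- If $(A,\rightarrow,\rightsquigarrow,1)$ is a commutative pseudo-BE algebra, then every deductive system of $A$ is fantastic, i.e. $\mathcal{DS}(A)=\mathcal{DS}_f(A)$.
   Context: A pseudo-BE algebra is an algebra $(A,\rightarrow,\rightsquigarrow,1)$ of type $(2,2,0)$ such that for all $x,y,z\in A$: $x\rightarrow x=x\rightsquigarrow x=1$; $x\rightarrow 1=x\rightsquigarrow 1=1$; $1\rightarrow x=1\rightsquigarrow x=x$; $x\rightarrow(y\rightsquigarrow z)=y\rightsquigarrow(x\rightarrow z)$; $x\rightarrow y=1$ iff $x\rightsquigarrow y=1$. Put $x\vee_1 y=(x\rightarrow y)\rightsquigarrow y$, $x\vee_2 y=(x\rightsquigarrow y)\rightarrow y$; $A$ is commutative if $x\vee_1 y=y\vee_1 x$ and $x\vee_2 y=y\vee_2 x$ for all $x,y$. $\mathcal{DS}(A)$ is the set of deductive systems: $D\subseteq A$ with $1\in D$ such that $x\in D$, $x\rightarrow y\in D$ imply $y\in D$. $\mathcal{DS}_f(A)$ is the set of fantastic ones: deductive systems $D$ such that for all $x,y$, $y\rightarrow x\in D$ implies $(x\vee_1 y)\rightarrow x\in D$ and $y\rightsquigarrow x\in D$ implies $(x\vee_2 y)\rightsquigarrow x\in D$. -}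

module Defs where

open import Level using (Level; suc; _⊔_)
open import Relation.Binary.PropositionalEquality using (_≡_)
open import Function.Bundles using (_⇔_)

record PseudoBE (a : Level) : Set (suc a) where
  infixr 5 _⇒_ _⇝_
  field
    Carrier : Set a
    _⇒_     : Carrier → Carrier → Carrier
    _⇝_     : Carrier → Carrier → Carrier
    𝟏       : Carrier
    ⇒-refl  : ∀ x → x ⇒ x ≡ 𝟏
    ⇝-refl  : ∀ x → x ⇝ x ≡ 𝟏
    ⇒-top   : ∀ x → x ⇒ 𝟏 ≡ 𝟏
    ⇝-top   : ∀ x → x ⇝ 𝟏 ≡ 𝟏
    ⇒-unit  : ∀ x → 𝟏 ⇒ x ≡ x
    ⇝-unit  : ∀ x → 𝟏 ⇝ x ≡ x
    exch    : ∀ x y z → x ⇒ (y ⇝ z) ≡ y ⇝ (x ⇒ z)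
    ⇒⇔⇝     : ∀ x y → (x ⇒ y ≡ 𝟏) ⇔ (x ⇝ y ≡ 𝟏)

  _∨₁_ : Carrier → Carrier → Carrier
  x ∨₁ y = (x ⇒ y) ⇝ y

  _∨₂_ : Carrier → Carrier → Carrier
  x ∨₂ y = (x ⇝ y) ⇒ y

module _ {a : Level} (A : PseudoBE a) where
  open PseudoBE A

  IsCommutative : Set a
  IsCommutative = (∀ x y → x ∨₁ y ≡ y ∨₁ x) × (∀ x y → x ∨₂ y ≡ y ∨₂ x)
    where open import Data.Product using (_×_)

  record IsDeductiveSystem {ℓ : Level} (D : Carrier → Set ℓ) : Set (a ⊔ ℓ) where
    field
      contains-𝟏 : D 𝟏
      mp         : ∀ {x y} → D x → D (x ⇒ y) → D y

  record IsFantastic {ℓ : Level} (D : Carrier → Set ℓ) : Set (a ⊔ ℓ) where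
    field
      isDS : IsDeductiveSystem D
      fant₁ : ∀ {x y} → D (y ⇒ x) → D ((x ∨₁ y) ⇒ x)
      fant₂ : ∀ {x y} → D (y ⇝ x) → D ((x ∨₂ y) ⇝ x)

module Submission where

-- In a commutative pseudo-BE algebra the fantastic conditions hold for every
-- subset of A, because their hypothesis and conclusion name the same element:
--   (x ∨₁ y) → x = (y → x) ∨₂ x = x ∨₂ (y → x) = y → x,
-- using commutativity of ∨₁, then of ∨₂, and finally the absorption law
-- "u ⇝ v = 1 implies u ∨₂ v = v" together with the weakening law
-- x ⇝ (y → x) = 1, a consequence of the exchange axiom.  The identity
-- (x ∨₂ y) ⇝ x = y ⇝ x is the mirror image.

open import Defs
open import Level using (Level)
open import Data.Product using (_,_)
open import Relation.Binary.PropositionalEquality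

module PseudoBELaws {a : Level} (A : PseudoBE a) where
  open PseudoBE A
  open ≡-Reasoning

  ⇝-weaken : ∀ x y → x ⇝ (y ⇒ x) ≡ 𝟏
  ⇝-weaken x y = begin
    x ⇝ (y ⇒ x)  ≡⟨ sym (exch y x x) ⟩
    y ⇒ (x ⇝ x)  ≡⟨ cong (y ⇒_) (⇝-refl x) ⟩
    y ⇒ 𝟏        ≡⟨ ⇒-top y ⟩
    𝟏            ∎

  ⇒-weaken : ∀ x y → x ⇒ (y ⇝ x) ≡ 𝟏
  ⇒-weaken x y = begin
    x ⇒ (y ⇝ x)  ≡⟨ exch x y x ⟩
    y ⇝ (x ⇒ x)  ≡⟨ cong (y ⇝_) (⇒-refl x) ⟩
    y ⇝ 𝟏        ≡⟨ ⇝-top y ⟩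
    𝟏            ∎

  ∨₁-absorb : ∀ {u v} → u ⇒ v ≡ 𝟏 → u ∨₁ v ≡ v
  ∨₁-absorb {u} {v} u≤v = trans (cong (_⇝ v) u≤v) (⇝-unit v)

  ∨₂-absorb : ∀ {u v} → u ⇝ v ≡ 𝟏 → u ∨₂ v ≡ v
  ∨₂-absorb {u} {v} u≤v = trans (cong (_⇒ v) u≤v) (⇒-unit v)

  ∨₁-residual : IsCommutative A → ∀ x y → (x ∨₁ y) ⇒ x ≡ y ⇒ x
  ∨₁-residual (comm₁ , comm₂) x y = begin
    (x ∨₁ y) ⇒ x    ≡⟨ cong (_⇒ x) (comm₁ x y) ⟩
    (y ⇒ x) ∨₂ x    ≡⟨ comm₂ (y ⇒ x) x ⟩
    x ∨₂ (y ⇒ x)    ≡⟨ ∨₂-absorb (⇝-weaken x y) ⟩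
    y ⇒ x           ∎

  ∨₂-residual : IsCommutative A → ∀ x y → (x ∨₂ y) ⇝ x ≡ y ⇝ x
  ∨₂-residual (comm₁ , comm₂) x y = begin
    (x ∨₂ y) ⇝ x    ≡⟨ cong (_⇝ x) (comm₂ x y) ⟩
    (y ⇝ x) ∨₁ x    ≡⟨ comm₁ (y ⇝ x) x ⟩
    x ∨₁ (y ⇝ x)    ≡⟨ ∨₁-absorb (⇒-weaken x y) ⟩
    y ⇝ x           ∎

theorem5p6 : {a ℓ : Level} (A : PseudoBE a) → IsCommutative A →
    (D : PseudoBE.Carrier A → Set ℓ) →
    IsDeductiveSystem A D → IsFantastic A D
theorem5p6 A comm D isDS = record
  { isDS  = isDS
  ; fant₁ = λ {x} {y} → subst D (sym (∨₁-residual comm x y))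
  ; fant₂ = λ {x} {y} → subst D (sym (∨₂-residual comm x y))
  }
  where open PseudoBELaws A
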